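{- Let $\succ$ be a complete strict social rule on $X$. A social outcome $z\in X$ is a local optimum for every objects scheme if and only if $z$ is the only element of the maximal irreducible component $\mathcal T_{\max}$ of the tournament of $\succ$.
   Context: Fix $n\ge1$ and positive integers $m_1,\dots,m_n$; social outcomes are $n$-tuples $x$ with $0\le x_i<m_i$, forming $X$. A complete strict social rule $\succ$ on $X$: for distinct $x,y$ exactly one of $x\succ y$, $y\succ x$ (not necessarily transitive); view it as a tournament with an arc $x\to y$ when $x\succ y$. The irreducible components are the maximal sub-tournaments in which every two nodes lie on a common directed cycle; they partition $X$ and are indexed $\mathcal T_1,\dots,\mathcal T_r$ so that for $i>j$ every node of $\mathcal T_i$ dominates every node of $\mathcal T_j$; $\mathcal T_{\max}=\mathcal T_r$. An object is a nonempty $I\subseteq\{1,\dots,n\}$; an objects scheme is a finite set $A$ of objects with union $\{1,\dots,n\}$. $\Phi(x,I)=\{y: y\succ x,\ y_i=x_i\ \forall i\notin I\}$; $x$ is a local optimum for $A$ if $\Phi(x,I)=\emptyset$ for all $I\in A$. -}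

module Defs where

open import Data.Nat using (ℕ; _<_)
open import Data.Fin using (Fin)
open import Data.Vec using (Vec; lookup)
open import Data.Fin.Subset using (Subset; _∈_; _∉_; Nonempty)
open import Data.List using (List)
import Data.List.Membership.Propositional as LM
open import Data.Product using (Σ; _×_; ∃)
open import Data.Sum using (_⊎_)
open import Data.Empty using (⊥)
open import Relation.Nullary using (¬_)
open import Relation.Binary.PropositionalEquality using (_≡_)

Outcome : ℕ → Set
Outcome n = Vec ℕ n

InX : ∀ {n} → Vec ℕ n → Outcome n → Set
InX m x = ∀ i → lookup x i < lookup m i

Positive : ∀ {n} → Vec ℕ n → Set
Positive m = ∀ i → 0 < lookup m i

Rel : ℕ → Set₁
Rel n = Outcome n → Outcome n → Set

IsCompleteStrict : ∀ {n} → Vec ℕ n → Rel n → Set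
IsCompleteStrict m _≻_ =
  (∀ x → InX m x → ¬ (x ≻ x)) ×
  (∀ x y → InX m x → InX m y → ¬ (x ≡ y) → (x ≻ y) ⊎ (y ≻ x)) ×
  (∀ x y → InX m x → InX m y → x ≻ y → ¬ (y ≻ x))

data Reach {n} (m : Vec ℕ n) (_≻_ : Rel n) : Outcome n → Outcome n → Set where
  edge : ∀ {x y} → x ≻ y → Reach m _≻_ x y
  cons : ∀ {x y z} → x ≻ y → InX m y → Reach m _≻_ y z → Reach m _≻_ x z

SameComp : ∀ {n} → Vec ℕ n → Rel n → Outcome n → Outcome n → Set
SameComp m _≻_ x y = (x ≡ y) ⊎ (Reach m _≻_ x y × Reach m _≻_ y x)

-- x belongs to the maximal irreducible component T_max: every node of the
-- component of x dominates every node of X outside that component.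
InTmax : ∀ {n} → Vec ℕ n → Rel n → Outcome n → Set
InTmax m _≻_ x =
  ∀ v w → InX m v → InX m w → SameComp m _≻_ x v → ¬ SameComp m _≻_ x w → v ≻ w

IsObjectsScheme : ∀ {n} → List (Subset n) → Set
IsObjectsScheme {n} A =
  (∀ I → I LM.∈ A → Nonempty I) × (∀ (i : Fin n) → ∃ λ I → I LM.∈ A × i ∈ I)

PhiEmpty : ∀ {n} → Vec ℕ n → Rel n → Outcome n → Subset n → Set
PhiEmpty m _≻_ x I =
  ∀ y → InX m y → y ≻ x → (∀ i → i ∉ I → lookup y i ≡ lookup x i) → ⊥

IsLocalOptimum : ∀ {n} → Vec ℕ n → Rel n → List (Subset n) → Outcome n → Set
IsLocalOptimum m _≻_ A x = ∀ I → I LM.∈ A → PhiEmpty m _≻_ x I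

-- For the scheme whose only object is {1,…,n}, Φ(z, I) is the set of all
-- outcomes beating z; so z is a local optimum for every objects scheme
-- exactly when no outcome beats z.
-- An unbeaten z is reached by no directed path, so its component is {z}
-- and z beats everything else, i.e. T_max = {z}.  If T_max = {z} and some
-- y beat z, then y would be either outside T_max (so z ≻ y, contradicting
-- asymmetry) or in the component of z, hence in T_max, hence equal to z
-- (contradicting irreflexivity).
module Submission where

open import Defs
open import Data.Nat using (ℕ; suc; _≤_; _≟_)
open import Data.Vec using (Vec)
open import Data.Vec.Properties using (≡-dec)
open import Data.Fin using (zero)
open import Data.Fin.Subset using (Subset; ⊤)
open import Data.Fin.Subset.Properties using (∈⊤)
open import Data.List using (List; [_])
open import Data.List.Relation.Unary.Any using (here)
open import Data.Product using (_×_; _,_; proj₁; proj₂)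
open import Data.Sum using (_⊎_; inj₁; inj₂)
open import Relation.Nullary using (¬_; yes; no; contradiction)
open import Relation.Nullary.Decidable using (decidable-stable; ¬¬-excluded-middle)
open import Relation.Binary.PropositionalEquality using (_≡_; refl; sym; subst)
open import Function.Bundles using (_⇔_; mk⇔)
import Function.Properties.Equivalence as ⇔

Unbeaten : ∀ {n} → Vec ℕ n → Rel n → Outcome n → Set
Unbeaten m _≻_ z = ∀ y → InX m y → ¬ (y ≻ z)

module _ {n : ℕ} (m : Vec ℕ n) (_≻_ : Rel n) where

  Reach-trans : ∀ {x y z} → InX m y → Reach m _≻_ x y → Reach m _≻_ y z → Reach m _≻_ x z
  Reach-trans yX (edge x≻y)       r = cons x≻y yX r
  Reach-trans yX (cons x≻w wX r₁) r = cons x≻w wX (Reach-trans yX r₁ r)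

  SameComp-sym : ∀ {x y} → SameComp m _≻_ x y → SameComp m _≻_ y x
  SameComp-sym (inj₁ x≡y)       = inj₁ (sym x≡y)
  SameComp-sym (inj₂ (xy , yx)) = inj₂ (yx , xy)

  SameComp-trans : ∀ {x y z} → InX m y →
                   SameComp m _≻_ x y → SameComp m _≻_ y z → SameComp m _≻_ x z
  SameComp-trans yX (inj₁ refl)      s                = s
  SameComp-trans yX (inj₂ r)         (inj₁ refl)      = inj₂ r
  SameComp-trans yX (inj₂ (xy , yx)) (inj₂ (yz , zy)) =
    inj₂ (Reach-trans yX xy yz , Reach-trans yX zy yx)

  InTmax-resp-SameComp : ∀ {x y} → InX m x → InX m y →
                         SameComp m _≻_ x y → InTmax m _≻_ x → InTmax m _≻_ y
  InTmax-resp-SameComp xX yX x~y tx v w vX wX y~v ¬y~w =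
    tx v w vX wX (SameComp-trans yX x~y y~v)
      (λ x~w → ¬y~w (SameComp-trans xX (SameComp-sym x~y) x~w))

  unbeaten⇒¬Reach : ∀ {z v} → Unbeaten m _≻_ z → InX m v → ¬ Reach m _≻_ v z
  unbeaten⇒¬Reach unb vX (edge v≻z)      = unb _ vX v≻z
  unbeaten⇒¬Reach unb vX (cons _ yX y⇝z) = unbeaten⇒¬Reach unb yX y⇝z

  unbeaten⇒SameComp⇒≡ : ∀ {z v} → Unbeaten m _≻_ z → InX m v → SameComp m _≻_ z v → v ≡ z
  unbeaten⇒SameComp⇒≡ unb vX (inj₁ z≡v) = sym z≡v
  unbeaten⇒SameComp⇒≡ unb vX (inj₂ (_ , v⇝z)) =
    contradiction v⇝z (unbeaten⇒¬Reach unb vX)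

  module _ (strict : IsCompleteStrict m _≻_) where

    private
      irrefl : ∀ {x} → InX m x → ¬ (x ≻ x)
      irrefl = proj₁ strict _

      total : ∀ x y → InX m x → InX m y → ¬ (x ≡ y) → (x ≻ y) ⊎ (y ≻ x)
      total = proj₁ (proj₂ strict)

      asym : ∀ x y → InX m x → InX m y → x ≻ y → ¬ (y ≻ x)
      asym = proj₂ (proj₂ strict)

    unbeaten⇒InTmax : ∀ {z} → InX m z → Unbeaten m _≻_ z → InTmax m _≻_ z
    unbeaten⇒InTmax zX unb v w vX wX z~v ¬z~w with unbeaten⇒SameComp⇒≡ unb vX z~v
    ... | refl with total v w zX wX (λ z≡w → ¬z~w (inj₁ z≡w))
    ...   | inj₁ z≻w = z≻w
    ...   | inj₂ w≻z = contradiction w≻z (unb w wX)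

    unbeaten⇒InTmax⇒≡ : ∀ {z y} → InX m z → Unbeaten m _≻_ z →
                        InX m y → InTmax m _≻_ y → y ≡ z
    unbeaten⇒InTmax⇒≡ {z} {y} zX unb yX ty = decidable-stable (≡-dec _≟_ y z) ¬¬y≡z
      where
      ¬¬y≡z : ¬ ¬ (y ≡ z)
      ¬¬y≡z y≢z = unb y yX (ty y z yX zX (inj₁ refl) ¬y~z)
        where
        ¬y~z : ¬ SameComp m _≻_ y z
        ¬y~z (inj₁ y≡z)       = y≢z y≡z
        ¬y~z (inj₂ (y⇝z , _)) = unbeaten⇒¬Reach unb yX y⇝z

    uniqueInTmax⇒unbeaten : ∀ {z} → InX m z → InTmax m _≻_ z →
                            (∀ y → InX m y → InTmax m _≻_ y → y ≡ z) → Unbeaten m _≻_ z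
    uniqueInTmax⇒unbeaten {z} zX tz uniq y yX y≻z = ¬¬-excluded-middle λ where
      (yes z~y) → irrefl zX (subst (_≻ z) (uniq y yX (InTmax-resp-SameComp zX yX z~y tz)) y≻z)
      (no ¬z~y) → asym y z yX zX y≻z (tz z y zX yX (inj₁ refl) ¬z~y)

    unbeaten⇔uniqueInTmax : ∀ {z} → InX m z →
      Unbeaten m _≻_ z ⇔ (InTmax m _≻_ z × (∀ y → InX m y → InTmax m _≻_ y → y ≡ z))
    unbeaten⇔uniqueInTmax zX = mk⇔
      (λ unb → unbeaten⇒InTmax zX unb , λ y yX → unbeaten⇒InTmax⇒≡ zX unb yX)
      (λ (tz , uniq) → uniqueInTmax⇒unbeaten zX tz uniq)

  unbeaten⇒IsLocalOptimum : ∀ {z} → Unbeaten m _≻_ z → ∀ A → IsLocalOptimum m _≻_ A z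
  unbeaten⇒IsLocalOptimum unb A _ _ y yX y≻z _ = unb y yX y≻z

full-isObjectsScheme : ∀ {k} → IsObjectsScheme {suc k} [ ⊤ ]
full-isObjectsScheme = (λ { _ (here refl) → zero , ∈⊤ }) , (λ i → ⊤ , here refl , ∈⊤)

module _ {k : ℕ} (m : Vec ℕ (suc k)) (_≻_ : Rel (suc k)) where

  IsLocalOptimum-full⇒unbeaten : ∀ {z} → IsLocalOptimum m _≻_ [ ⊤ ] z → Unbeaten m _≻_ z
  IsLocalOptimum-full⇒unbeaten opt y yX y≻z =
    opt ⊤ (here refl) y yX y≻z (λ i i∉⊤ → contradiction ∈⊤ i∉⊤)

  allLocalOptimum⇔unbeaten : ∀ {z} →
    (∀ A → IsObjectsScheme A → IsLocalOptimum m _≻_ A z) ⇔ Unbeaten m _≻_ z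
  allLocalOptimum⇔unbeaten = mk⇔
    (λ opt → IsLocalOptimum-full⇒unbeaten (opt [ ⊤ ] full-isObjectsScheme))
    (λ unb A _ → unbeaten⇒IsLocalOptimum m _≻_ unb A)

mainTheorem6 : (n : ℕ) → 1 ≤ n → (m : Vec ℕ n) → Positive m →
    (_≻_ : Rel n) → IsCompleteStrict m _≻_ →
    (z : Outcome n) → InX m z →
    ((∀ (A : List (Subset n)) → IsObjectsScheme A → IsLocalOptimum m _≻_ A z)
      ⇔ (InTmax m _≻_ z × (∀ y → InX m y → InTmax m _≻_ y → y ≡ z)))
mainTheorem6 (suc k) _ m _ _≻_ strict z zX =
  ⇔.trans (allLocalOptimum⇔unbeaten m _≻_) (unbeaten⇔uniqueInTmax m _≻_ strict zX)
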